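{- For every positive integer $n$, the number of isometry classes of $n$-point metric spaces in $\mathcal{A}^3_{\infty,0,7,8}$ is $$\frac{\lfloor n/2\rfloor^2}{2}+\frac{3\lfloor n/2\rfloor}{2}+1.$$
   Context: $\mathcal{A}^3_{\infty,0,7,8}$ is the class of finite metric spaces, all of whose distances between distinct points lie in $\{1,2,3\}$, in which for every three distinct points the multiset of their pairwise distances is one of $\{1,1,2\}$, $\{1,2,3\}$, $\{2,2,2\}$. -}

module Defs where

open import Data.Nat using (ℕ; _+_; _≤_)
open import Data.Fin using (Fin)
open import Data.Fin.Permutation using (Permutation′; _⟨$⟩ʳ_)
open import Data.List using (List; _∷_; [])
open import Data.List.Relation.Binary.Permutation.Propositional using (_↭_)
open import Data.Product using (Σ; _×_)
open import Data.Sum using (_⊎_)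
open import Relation.Binary.PropositionalEquality using (_≡_; _≢_)
open import Relation.Nullary using (¬_)

record IsMetric (n : ℕ) (d : Fin n → Fin n → ℕ) : Set where
  field
    zero-iff : ∀ x y → d x y ≡ 0 → x ≡ y
    refl-0   : ∀ x → d x x ≡ 0
    symm     : ∀ x y → d x y ≡ d y x
    triangle : ∀ x y z → d x z ≤ d x y + d y z

record MetricSpace (n : ℕ) : Set where
  field
    dist     : Fin n → Fin n → ℕ
    isMetric : IsMetric n dist
open MetricSpace public

AllowedTriangle : ℕ → ℕ → ℕ → Set
AllowedTriangle a b c =
  ((a ∷ b ∷ c ∷ []) ↭ (1 ∷ 1 ∷ 2 ∷ [])) ⊎
  (((a ∷ b ∷ c ∷ []) ↭ (1 ∷ 2 ∷ 3 ∷ [])) ⊎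
   ((a ∷ b ∷ c ∷ []) ↭ (2 ∷ 2 ∷ 2 ∷ [])))

InClass : ∀ {n} → MetricSpace n → Set
InClass {n} M =
  (∀ x y → x ≢ y → (dist M x y ≡ 1 ⊎ (dist M x y ≡ 2 ⊎ dist M x y ≡ 3))) ×
  (∀ x y z → x ≢ y → y ≢ z → x ≢ z →
     AllowedTriangle (dist M x y) (dist M y z) (dist M x z))

Isometric : ∀ {n} → MetricSpace n → MetricSpace n → Set
Isometric {n} M N =
  Σ (Permutation′ n) λ σ → ∀ x y → dist N (σ ⟨$⟩ʳ x) (σ ⟨$⟩ʳ y) ≡ dist M x y

NumIsoClasses : ℕ → ℕ → Set
NumIsoClasses n k =
  Σ (Fin k → MetricSpace n) λ rep →
    (∀ i → InClass (rep i)) ×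
    ((∀ i j → i ≢ j → ¬ Isometric (rep i) (rep j)) ×
     (∀ (M : MetricSpace n) → InClass M → Σ (Fin k) λ i → Isometric M (rep i)))

-- Every allowed triangle has perimeter 4 or 6. Hence, in a space of the class, the parity of
-- d(x, y) is the sum of the parities of d(x₀, x) and d(x₀, y) for a fixed base point x₀: the
-- points split into two sides, at distance 2 within a side and 1 or 3 across, and since
-- 3 + 3 + 1 > 6 no point is at distance 3 from two others. Conversely every such matched
-- bipartition lies in the class. Up to isometry it is determined by the size a ≤ ⌊n/2⌋ of a
-- smaller side and the number j ≤ a of pairs at distance 3: ranking the points by side and
-- partner is an isometry onto the model R(a, j) on {0, …, n − 1} with sides [0, a) and [a, n)
-- in which p < j is at distance 3 from a + p. Side sizes and the number of points with a
-- partner are isometry invariants, so the models are pairwise non-isometric, and there are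
-- Σ_{a ≤ m} (a + 1) = (m + 1)(m + 2)/2 of them, where m = ⌊n/2⌋.

module Submission where

open import Defs
open import Data.Bool using (if_then_else_)
open import Data.Fin using (Fin; zero; suc; toℕ; fromℕ<; splitAt; join; _↑ˡ_; _↑ʳ_)
import Data.Fin as Fin
open import Data.Fin.Permutation using (Permutation′; _⟨$⟩ʳ_; _⟨$⟩ˡ_; permutation; inverseʳ; flip)
open import Data.Fin.Properties using (punchOut-injective; injective⇒≤; any?)
import Data.Fin.Properties as Finₚ
open import Data.List using (_∷_; [])
open import Data.List.Relation.Binary.Permutation.Propositional using (_↭_; ↭-refl; ↭-trans; prep; swap)
open import Data.Nat using (ℕ; zero; suc; _+_; _*_; _∸_; _/_; _≤_; _<_; z≤n; s≤s; s≤s⁻¹; parity)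
open import Data.Nat.DivMod using (m/n*n≤m; m*n/n≡m; /-monoˡ-≤)
open import Data.Nat.ListAction using (sum)
open import Data.Nat.ListAction.Properties using (sum-↭)
open import Data.Nat.Properties
open import Data.Nat.Tactic.RingSolver using (solve-∀)
open import Data.Parity using (Parity; 0ℙ; 1ℙ; _⁻¹)
import Data.Parity as ℙ
import Data.Parity.Properties as ℙₚ
open import Data.Empty using (⊥-elim)
open import Data.Product using (Σ; ∃; ∃₂; _×_; _,_; proj₁; proj₂; map₂; uncurry)
open import Data.Sum using (_⊎_; inj₁; inj₂; [_,_]′)
import Data.Sum as Sum
open import Function using (_∘_; _⇔_; mk⇔; Equivalence)
open import Function.Bundles using (Injection)
open import Function.Definitions using (Injective)
open import Function.Properties.Inverse using (↔⇒↣)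
open import Level using (0ℓ)
open import Relation.Binary using (tri<; tri≈; tri>)
open import Relation.Binary.PropositionalEquality
open import Relation.Nullary using (¬_; Dec; yes; no; does; contradiction; _×-dec_; _⊎-dec_)
open import Relation.Nullary.Decidable using (decidable-stable)
open import Relation.Unary using (Pred; Decidable; _⊆_; _≐_)
open import Relation.Unary.Properties using (_∩?_; ∁?)

-- Allowed triangles

Distance : ℕ → Set
Distance k = k ≡ 1 ⊎ (k ≡ 2 ⊎ k ≡ 3)

Cross : ℕ → Set
Cross u = u ≡ 1 ⊎ u ≡ 3

perimeter≡sum : ∀ a b c → a + b + c ≡ sum (a ∷ b ∷ c ∷ [])
perimeter≡sum a b c = trans (+-assoc a b c) (cong (λ k → a + (b + k)) (sym (+-identityʳ c)))

allowed-perimeter : ∀ {a b c} → AllowedTriangle a b c → a + b + c ≡ 4 ⊎ a + b + c ≡ 6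
allowed-perimeter {a} {b} {c} (inj₁ p)        = inj₁ (trans (perimeter≡sum a b c) (sum-↭ p))
allowed-perimeter {a} {b} {c} (inj₂ (inj₁ p)) = inj₂ (trans (perimeter≡sum a b c) (sum-↭ p))
allowed-perimeter {a} {b} {c} (inj₂ (inj₂ p)) = inj₂ (trans (perimeter≡sum a b c) (sum-↭ p))

allowed-resp-↭ : ∀ {a b c a′ b′ c′} → (a′ ∷ b′ ∷ c′ ∷ []) ↭ (a ∷ b ∷ c ∷ []) →
                 AllowedTriangle a b c → AllowedTriangle a′ b′ c′
allowed-resp-↭ π = Sum.map (↭-trans π) (Sum.map (↭-trans π) (↭-trans π))

allowed-swap₁₂ : ∀ {a b c} → AllowedTriangle a b c → AllowedTriangle b a c
allowed-swap₁₂ {a} {b} = allowed-resp-↭ (swap b a ↭-refl)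

allowed-swap₂₃ : ∀ {a b c} → AllowedTriangle a b c → AllowedTriangle a c b
allowed-swap₂₃ {a} {b} {c} = allowed-resp-↭ (prep a (swap c b ↭-refl))

allowed-2-cross : ∀ {u v} → Cross u → Cross v → ¬ (u ≡ 3 × v ≡ 3) → AllowedTriangle 2 u v
allowed-2-cross (inj₁ refl) (inj₁ refl) _ = allowed-swap₁₂ (allowed-swap₂₃ (inj₁ ↭-refl))
allowed-2-cross (inj₁ refl) (inj₂ refl) _ = allowed-swap₁₂ (inj₂ (inj₁ ↭-refl))
allowed-2-cross (inj₂ refl) (inj₁ refl) _ = allowed-swap₂₃ (allowed-swap₁₂ (inj₂ (inj₁ ↭-refl)))
allowed-2-cross (inj₂ refl) (inj₂ refl) ¬33 = contradiction (refl , refl) ¬33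

allowed⇒triangle : ∀ {a b c} → 1 ≤ a → 1 ≤ b → c ≤ 3 → AllowedTriangle a b c → c ≤ a + b
allowed⇒triangle {a} {b} {c} 1≤a 1≤b c≤3 t with m≤n⇒m<n∨m≡n c≤3 | allowed-perimeter t
... | inj₁ c<3    | _      = ≤-trans (≤-pred c<3) (+-mono-≤ 1≤a 1≤b)
... | inj₂ refl   | inj₁ e = contradiction (+-cancelʳ-≡ 3 (a + b) 1 e)
                                 (>⇒≢ (+-mono-≤ 1≤a 1≤b))
... | inj₂ refl   | inj₂ e = ≤-reflexive (sym (+-cancelʳ-≡ 3 (a + b) 3 e))

-- Counting in Fin n

count : ∀ {n} {P : Pred (Fin n) 0ℓ} → Decidable P → ℕ
count {zero}  P? = 0
count {suc n} P? = if does (P? zero) then suc (count (P? ∘ suc)) else count (P? ∘ suc)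

count-mono : ∀ {n} {P Q : Pred (Fin n) 0ℓ} (P? : Decidable P) (Q? : Decidable Q) →
             P ⊆ Q → count P? ≤ count Q?
count-mono {zero}  P? Q? P⊆Q = z≤n
count-mono {suc n} P? Q? P⊆Q with P? zero | Q? zero
... | yes _ | yes _ = s≤s (count-mono (P? ∘ suc) (Q? ∘ suc) P⊆Q)
... | yes p | no ¬q = contradiction (P⊆Q p) ¬q
... | no _  | yes _ = m≤n⇒m≤1+n (count-mono (P? ∘ suc) (Q? ∘ suc) P⊆Q)
... | no _  | no _  = count-mono (P? ∘ suc) (Q? ∘ suc) P⊆Q

count-strict-mono : ∀ {n} {P Q : Pred (Fin n) 0ℓ} (P? : Decidable P) (Q? : Decidable Q) →
                    P ⊆ Q → ∀ {x} → Q x → ¬ P x → count P? < count Q?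
count-strict-mono {suc n} P? Q? P⊆Q {zero} q ¬p with P? zero | Q? zero
... | yes p | _     = contradiction p ¬p
... | no _  | yes _ = s≤s (count-mono (P? ∘ suc) (Q? ∘ suc) P⊆Q)
... | no _  | no ¬q = contradiction q ¬q
count-strict-mono {suc n} P? Q? P⊆Q {suc x} q ¬p with P? zero | Q? zero
... | yes _ | yes _ = s≤s (count-strict-mono (P? ∘ suc) (Q? ∘ suc) P⊆Q q ¬p)
... | yes p | no ¬q = contradiction (P⊆Q p) ¬q
... | no _  | yes _ = m<n⇒m<1+n (count-strict-mono (P? ∘ suc) (Q? ∘ suc) P⊆Q q ¬p)
... | no _  | no _  = count-strict-mono (P? ∘ suc) (Q? ∘ suc) P⊆Q q ¬p

count-cong : ∀ {n} {P Q : Pred (Fin n) 0ℓ} (P? : Decidable P) (Q? : Decidable Q) →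
             P ≐ Q → count P? ≡ count Q?
count-cong P? Q? (P⊆Q , Q⊆P) = ≤-antisym (count-mono P? Q? P⊆Q) (count-mono Q? P? Q⊆P)

count-split : ∀ {n} {P Q : Pred (Fin n) 0ℓ} (P? : Decidable P) (Q? : Decidable Q) →
              count P? ≡ count (P? ∩? Q?) + count (P? ∩? ∁? Q?)
count-split {zero}  P? Q? = refl
count-split {suc n} P? Q? with P? zero | Q? zero
... | yes _ | yes _ = cong suc (count-split (P? ∘ suc) (Q? ∘ suc))
... | yes _ | no _  = trans (cong suc (count-split (P? ∘ suc) (Q? ∘ suc))) (sym (+-suc _ _))
... | no _  | _     = count-split (P? ∘ suc) (Q? ∘ suc)

count-∁ : ∀ {n} {P : Pred (Fin n) 0ℓ} (P? : Decidable P) → count P? + count (∁? P?) ≡ n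
count-∁ {zero}  P? = refl
count-∁ {suc n} P? with P? zero
... | yes _ = cong suc (count-∁ (P? ∘ suc))
... | no _  = trans (+-suc _ _) (cong suc (count-∁ (P? ∘ suc)))

count-all : ∀ {n} {P : Pred (Fin n) 0ℓ} (P? : Decidable P) → (∀ x → P x) → count P? ≡ n
count-all {zero}  P? all = refl
count-all {suc n} P? all with P? zero
... | yes _ = cong suc (count-all (P? ∘ suc) (all ∘ suc))
... | no ¬p = contradiction (all zero) ¬p

count-none : ∀ {n} {P : Pred (Fin n) 0ℓ} (P? : Decidable P) → (∀ x → ¬ P x) → count P? ≡ 0
count-none {zero}  P? none = refl
count-none {suc n} P? none with P? zero
... | yes p = contradiction p (none zero)
... | no _  = count-none (P? ∘ suc) (none ∘ suc)

below? : ∀ {n} k → Decidable λ (x : Fin n) → toℕ x < k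
below? k x = toℕ x <? k

count-below : ∀ {n k} → k ≤ n → count (below? {n} k) ≡ k
count-below {zero}  {zero}  z≤n       = refl
count-below {suc n} {zero}  _         = count-none (below? {suc n} 0) λ _ ()
count-below {suc n} {suc k} (s≤s k≤n) =
  cong suc (trans (count-cong (below? {suc n} (suc k) ∘ suc) (below? k) (s≤s⁻¹ , s≤s))
                  (count-below k≤n))

count-injection : ∀ {m n} {P : Pred (Fin m) 0ℓ} {Q : Pred (Fin n) 0ℓ}
                  (P? : Decidable P) (Q? : Decidable Q) (f : Fin m → Fin n) → (∀ {x} → P x → Q (f x)) →
                  (∀ {x y} → P x → P y → f x ≡ f y → x ≡ y) → count P? ≤ count Q?
count-injection {zero}  P? Q? f f-maps f-inj = z≤n
count-injection {suc m} {Q = Q} P? Q? f f-maps f-inj with P? zero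
... | no _   = count-injection (P? ∘ suc) Q? (f ∘ suc) f-maps
                 (λ px py e → Finₚ.suc-injective (f-inj px py e))
... | yes p₀ = begin-strict
  count (P? ∘ suc)          ≤⟨ count-injection (P? ∘ suc) Q∖f₀? (f ∘ suc)
                                (λ px → f-maps px , λ e → Finₚ.0≢1+n (f-inj p₀ px (sym e)))
                                (λ px py e → Finₚ.suc-injective (f-inj px py e)) ⟩
  count Q∖f₀?               <⟨ count-strict-mono Q∖f₀? Q? proj₁ (f-maps p₀) (λ (_ , f₀≢f₀) → f₀≢f₀ refl) ⟩
  count Q?                  ∎
  where
  open ≤-Reasoning
  Q∖f₀? : Decidable λ y → Q y × y ≢ f zero
  Q∖f₀? = Q? ∩? ∁? (Finₚ._≟ f zero)

count-permute : ∀ {n} {P Q : Pred (Fin n) 0ℓ} (P? : Decidable P) (Q? : Decidable Q)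
                (σ : Permutation′ n) →
                (∀ x → P x ⇔ Q (σ ⟨$⟩ʳ x)) → count P? ≡ count Q?
count-permute {Q = Q} P? Q? σ P⇔Q∘σ = ≤-antisym
  (count-injection P? Q? (σ ⟨$⟩ʳ_) (Equivalence.to (P⇔Q∘σ _)) λ _ _ → Injection.injective (↔⇒↣ σ))
  (count-injection Q? P? (σ ⟨$⟩ˡ_)
    (λ q → Equivalence.from (P⇔Q∘σ _) (subst Q (sym (inverseʳ σ)) q))
    λ _ _ → Injection.injective (↔⇒↣ (flip σ)))

rank : ∀ {n} {P : Pred (Fin n) 0ℓ} → Decidable P → Fin n → ℕ
rank P? x = count (P? ∩? (Fin._<? x))

module _ {n} {P : Pred (Fin n) 0ℓ} (P? : Decidable P) where

  rank-< : ∀ {x} → P x → rank P? x < count P?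
  rank-< {x} px = count-strict-mono (P? ∩? (Fin._<? x)) P? proj₁ px λ (_ , x<x) → <-irrefl refl x<x

  rank-strictMono : ∀ {x y} → P x → x Fin.< y → rank P? x < rank P? y
  rank-strictMono {x} {y} px x<y = count-strict-mono (P? ∩? (Fin._<? x)) (P? ∩? (Fin._<? y))
    (λ (p , z<x) → p , <-trans z<x x<y) (px , x<y) λ (_ , x<x) → <-irrefl refl x<x

  rank-injective : ∀ {x y} → P x → P y → rank P? x ≡ rank P? y → x ≡ y
  rank-injective {x} {y} px py e with Finₚ.<-cmp x y
  ... | tri< x<y _ _ = contradiction e (<⇒≢ (rank-strictMono px x<y))
  ... | tri≈ _ x≡y _ = x≡y
  ... | tri> _ _ y<x = contradiction (sym e) (<⇒≢ (rank-strictMono py y<x))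

injective⇒surjective : ∀ {n} {f : Fin n → Fin n} → Injective _≡_ _≡_ f → ∀ y → ∃ λ x → f x ≡ y
injective⇒surjective {suc n} {f} f-inj y with any? (λ x → f x Finₚ.≟ y)
... | yes hit = hit
... | no miss = contradiction (injective⇒≤ f∖y-injective) 1+n≰n
  where
  y≢f : ∀ x → y ≢ f x
  y≢f x y≡fx = miss (x , sym y≡fx)
  f∖y : Fin (suc n) → Fin n
  f∖y x = Fin.punchOut (y≢f x)
  f∖y-injective : Injective _≡_ _≡_ f∖y
  f∖y-injective {x} {x′} e = f-inj (punchOut-injective (y≢f x) (y≢f x′) e)

injective⇒permutation : ∀ {n} (f : Fin n → Fin n) → Injective _≡_ _≡_ f →
                        Σ (Permutation′ n) λ σ → ∀ x → σ ⟨$⟩ʳ x ≡ f x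
injective⇒permutation f f-inj =
  permutation f (proj₁ ∘ surj) (proj₂ ∘ surj) (λ x → f-inj (proj₂ (surj (f x)))) , λ _ → refl
  where surj = injective⇒surjective f-inj

count-not-below : ∀ {n k} → k ≤ n → count (∁? (below? {n} k)) ≡ n ∸ k
count-not-below {n} {k} k≤n = begin
  count ≥k?                        ≡⟨ m+n∸m≡n k _ ⟨
  k + count ≥k? ∸ k                ≡⟨ cong (λ c → c + count ≥k? ∸ k) (count-below k≤n) ⟨
  count (below? {n} k) + count ≥k? ∸ k ≡⟨ cong (_∸ k) (count-∁ (below? {n} k)) ⟩
  n ∸ k                            ∎
  where
  open ≡-Reasoning
  ≥k? : Decidable λ (x : Fin n) → ¬ toℕ x < k
  ≥k? = ∁? (below? k)

count-interval : ∀ {n a j} → a + j ≤ n → count (below? {n} (a + j) ∩? ∁? (below? {n} a)) ≡ j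
count-interval {n} {a} {j} a+j≤n = +-cancelˡ-≡ a _ j (begin
  a + count interval?                       ≡⟨ cong (_+ count interval?) (count-below a≤n) ⟨
  count (below? {n} a) + count interval?    ≡⟨ cong (_+ count interval?) (count-cong (below? {n} a) <a+j∧<a?
                                                 ((λ x<a → <-≤-trans x<a (m≤m+n a j) , x<a) , proj₂)) ⟩
  count <a+j∧<a? + count interval?          ≡⟨ count-split (below? {n} (a + j)) (below? {n} a) ⟨
  count (below? {n} (a + j))                    ≡⟨ count-below a+j≤n ⟩
  a + j                                     ∎)
  where
  open ≡-Reasoning
  a≤n : a ≤ n
  a≤n = ≤-trans (m≤m+n a j) a+j≤n
  <a+j∧<a? : Decidable λ (x : Fin n) → toℕ x < a + j × toℕ x < a
  <a+j∧<a? = below? (a + j) ∩? below? a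
  interval? : Decidable λ (x : Fin n) → toℕ x < a + j × ¬ toℕ x < a
  interval? = below? (a + j) ∩? ∁? (below? a)

-- Matched bipartitions

0ℙ≢1ℙ : 0ℙ ≢ 1ℙ
0ℙ≢1ℙ ()

≢∧≢⇒≡ : ∀ {p q r : Parity} → p ≢ q → q ≢ r → p ≡ r
≢∧≢⇒≡ {0ℙ} {0ℙ}       p≢q _   = contradiction refl p≢q
≢∧≢⇒≡ {0ℙ} {1ℙ} {0ℙ} _   _   = refl
≢∧≢⇒≡ {0ℙ} {1ℙ} {1ℙ} _   q≢r = contradiction refl q≢r
≢∧≢⇒≡ {1ℙ} {0ℙ} {0ℙ} _   q≢r = contradiction refl q≢r
≢∧≢⇒≡ {1ℙ} {0ℙ} {1ℙ} _   _   = refl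
≢∧≢⇒≡ {1ℙ} {1ℙ}       p≢q _   = contradiction refl p≢q

p+q≡0ℙ⇒p≡q : ∀ {p q} → p ℙ.+ q ≡ 0ℙ → p ≡ q
p+q≡0ℙ⇒p≡q {p} {q} e = ℙₚ.+-cancelʳ-≡ q p q (trans e (sym (ℙₚ.p+p≡0ℙ q)))

⁻¹≡0ℙ⇒≢0ℙ : ∀ {p} → p ⁻¹ ≡ 0ℙ → p ≢ 0ℙ
⁻¹≡0ℙ⇒≢0ℙ {0ℙ} ()
⁻¹≡0ℙ⇒≢0ℙ {1ℙ} _ ()

≢0ℙ⇒⁻¹≡0ℙ : ∀ {p} → p ≢ 0ℙ → p ⁻¹ ≡ 0ℙ
≢0ℙ⇒⁻¹≡0ℙ {0ℙ} p≢0ℙ = contradiction refl p≢0ℙ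
≢0ℙ⇒⁻¹≡0ℙ {1ℙ} _    = refl

record MatchedBipartition {n} (d : Fin n → Fin n → ℕ) : Set where
  field
    side            : Fin n → Parity
    dist-same-side  : ∀ {x y} → x ≢ y → side x ≡ side y → d x y ≡ 2
    dist-cross-side : ∀ {x y} → side x ≢ side y → Cross (d x y)
    3-partner-unique : ∀ {x y z} → d x y ≡ 3 → d x z ≡ 3 → y ≡ z

  flip-sides : MatchedBipartition d
  flip-sides = record
    { side             = _⁻¹ ∘ side
    ; dist-same-side   = λ x≢y s → dist-same-side x≢y (ℙₚ.⁻¹-injective s)
    ; dist-cross-side  = λ s → dist-cross-side (s ∘ cong _⁻¹)
    ; 3-partner-unique = 3-partner-unique
    }

module MatchedBipartitionProperties {n} {d : Fin n → Fin n → ℕ}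
  (refl-0 : ∀ x → d x x ≡ 0) (symm : ∀ x y → d x y ≡ d y x) (B : MatchedBipartition d) where
  open MatchedBipartition B

  dist-range : ∀ {x y} → x ≢ y → Distance (d x y)
  dist-range {x} {y} x≢y with side x ℙₚ.≟ side y
  ... | yes s = inj₂ (inj₁ (dist-same-side x≢y s))
  ... | no s  = [ inj₁ , inj₂ ∘ inj₂ ]′ (dist-cross-side s)

  allowed : ∀ {x y z} → x ≢ y → y ≢ z → x ≢ z → AllowedTriangle (d x y) (d y z) (d x z)
  allowed {x} {y} {z} x≢y y≢z x≢z with side x ℙₚ.≟ side y | side y ℙₚ.≟ side z
  ... | yes sxy | yes syz
    rewrite dist-same-side x≢y sxy | dist-same-side y≢z syz | dist-same-side x≢z (trans sxy syz)
    = inj₂ (inj₂ ↭-refl)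
  ... | yes sxy | no syz rewrite dist-same-side x≢y sxy =
    allowed-2-cross (dist-cross-side syz) (dist-cross-side (syz ∘ trans (sym sxy)))
      λ (y3 , x3) → x≢y (3-partner-unique (trans (symm z x) x3) (trans (symm z y) y3))
  ... | no sxy | yes syz rewrite dist-same-side y≢z syz =
    allowed-swap₁₂ (allowed-2-cross (dist-cross-side sxy) (dist-cross-side λ sxz → sxy (trans sxz (sym syz)))
      λ (y3 , z3) → y≢z (3-partner-unique y3 z3))
  ... | no sxy | no syz rewrite dist-same-side x≢z (≢∧≢⇒≡ sxy syz) =
    allowed-swap₂₃ (allowed-swap₁₂ (allowed-2-cross (dist-cross-side sxy) (dist-cross-side syz)
      λ (x3 , z3) → x≢z (3-partner-unique (trans (symm y x) x3) z3)))

  triangle : ∀ x y z → d x z ≤ d x y + d y z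
  triangle x y z with x Finₚ.≟ y | y Finₚ.≟ z | x Finₚ.≟ z
  ... | yes refl | _        | _        rewrite refl-0 x = ≤-refl
  ... | no _     | yes refl | _        rewrite refl-0 y = m≤m+n (d x y) 0
  ... | no _     | no _     | yes refl rewrite refl-0 x = z≤n
  ... | no x≢y   | no y≢z   | no x≢z   =
    allowed⇒triangle (1≤ (dist-range x≢y)) (1≤ (dist-range y≢z)) (≤3 (dist-range x≢z))
                     (allowed x≢y y≢z x≢z)
    where
    1≤ : ∀ {k} → Distance k → 1 ≤ k
    1≤ (inj₁ refl)        = s≤s z≤n
    1≤ (inj₂ (inj₁ refl)) = s≤s z≤n
    1≤ (inj₂ (inj₂ refl)) = s≤s z≤n
    ≤3 : ∀ {k} → Distance k → k ≤ 3
    ≤3 (inj₁ refl)        = s≤s z≤n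
    ≤3 (inj₂ (inj₁ refl)) = s≤s (s≤s z≤n)
    ≤3 (inj₂ (inj₂ refl)) = ≤-refl

  even⇔same-side : ∀ x y → parity (d x y) ≡ 0ℙ ⇔ side x ≡ side y
  even⇔same-side x y with x Finₚ.≟ y
  ... | yes refl = mk⇔ (λ _ → refl) (λ _ → cong parity (refl-0 x))
  ... | no x≢y with side x ℙₚ.≟ side y
  ...   | yes s = mk⇔ (λ _ → s) (λ _ → cong parity (dist-same-side x≢y s))
  ...   | no s  = mk⇔ (λ even → contradiction even (odd (dist-cross-side s))) (λ s′ → contradiction s′ s)
    where
    odd : ∀ {k} → Cross k → parity k ≢ 0ℙ
    odd (inj₁ refl) ()
    odd (inj₂ refl) ()

allowed-parity : ∀ {a b c} → AllowedTriangle a b c → parity b ≡ parity a ℙ.+ parity c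
allowed-parity {a} {b} {c} t = trans (p+q≡0ℙ⇒p≡q (begin
  parity b ℙ.+ parity (a + c) ≡⟨ ℙₚ.+-homo-+ b (a + c) ⟨
  parity (b + (a + c))        ≡⟨ cong parity (trans (sym (+-assoc b a c)) (cong (_+ c) (+-comm b a))) ⟩
  parity (a + b + c)          ≡⟨ [ cong parity , cong parity ]′ (allowed-perimeter t) ⟩
  0ℙ                          ∎)) (ℙₚ.+-homo-+ a c)
  where open ≡-Reasoning

dist≡suc⇒≢ : ∀ {n} (M : MetricSpace n) {x y k} → dist M x y ≡ suc k → x ≢ y
dist≡suc⇒≢ M {x} e refl = contradiction (trans (sym e) (IsMetric.refl-0 (isMetric M) x)) λ ()

module _ {n} (M : MetricSpace n) (inM : InClass M) (x₀ : Fin n) where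
  open IsMetric (isMetric M)
  private
    d : Fin n → Fin n → ℕ
    d = dist M
    dist-range : ∀ {x y} → x ≢ y → Distance (d x y)
    dist-range = proj₁ inM _ _
    allowed : ∀ {x y z} → x ≢ y → y ≢ z → x ≢ z → AllowedTriangle (d x y) (d y z) (d x z)
    allowed = proj₂ inM _ _ _

  parity-cocycle : ∀ x y → parity (d x y) ≡ parity (d x₀ x) ℙ.+ parity (d x₀ y)
  parity-cocycle x y with x₀ Finₚ.≟ x | x₀ Finₚ.≟ y | x Finₚ.≟ y
  ... | yes refl | _        | _        rewrite refl-0 x₀ = refl
  ... | no _     | yes refl | _        rewrite refl-0 x₀ | symm x x₀ = sym (ℙₚ.+-identityʳ _)
  ... | no _     | no _     | yes refl rewrite refl-0 x = sym (ℙₚ.p+p≡0ℙ (parity (d x₀ x)))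
  ... | no x₀≢x  | no x₀≢y  | no x≢y   = allowed-parity (allowed x₀≢x x≢y x₀≢y)

  inClass⇒matchedBipartition : MatchedBipartition d
  inClass⇒matchedBipartition = record
    { side             = side
    ; dist-same-side   = λ {x} x≢y s → even-distance (dist-range x≢y)
                           (trans (parity-cocycle _ _) (trans (cong (side x ℙ.+_) (sym s)) (ℙₚ.p+p≡0ℙ (side x))))
    ; dist-cross-side  = λ {x} {y} s → odd-distance (dist-range (s ∘ cong side))
                           λ even → s (p+q≡0ℙ⇒p≡q (trans (sym (parity-cocycle x y)) even))
    ; 3-partner-unique = 3-partner-unique
    }
    where
    side : Fin n → Parity
    side x = parity (d x₀ x)
    even-distance : ∀ {k} → Distance k → parity k ≡ 0ℙ → k ≡ 2
    even-distance (inj₂ (inj₁ refl)) _ = refl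
    even-distance (inj₁ refl)        ()
    even-distance (inj₂ (inj₂ refl)) ()
    odd-distance : ∀ {k} → Distance k → parity k ≢ 0ℙ → Cross k
    odd-distance (inj₁ refl)        _   = inj₁ refl
    odd-distance (inj₂ (inj₁ refl)) odd = contradiction refl odd
    odd-distance (inj₂ (inj₂ refl)) _   = inj₂ refl
    3-partner-unique : ∀ {x y z} → d x y ≡ 3 → d x z ≡ 3 → y ≡ z
    3-partner-unique {x} {y} {z} y3 z3 with y Finₚ.≟ z
    ... | yes y≡z = y≡z
    ... | no y≢z with allowed-perimeter (allowed (dist≡suc⇒≢ M y3 ∘ sym) (dist≡suc⇒≢ M z3) y≢z)
    ...   | p rewrite symm y x | y3 | z3 = zero-iff y z (six+c≡perimeter p)
      where six+c≡perimeter : ∀ {c} → 6 + c ≡ 4 ⊎ 6 + c ≡ 6 → c ≡ 0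
            six+c≡perimeter (inj₁ ())
            six+c≡perimeter (inj₂ e) = +-cancelˡ-≡ 6 _ 0 e

-- The representative spaces R(a, j)

module Representative (a j : ℕ) where

  side : ℕ → Parity
  side p with p <? a
  ... | yes _ = 0ℙ
  ... | no _  = 1ℙ

  side-< : ∀ {p} → p < a → side p ≡ 0ℙ
  side-< {p} p<a with p <? a
  ... | yes _   = refl
  ... | no p≮a  = contradiction p<a p≮a

  side≡0ℙ⇒< : ∀ {p} → side p ≡ 0ℙ → p < a
  side≡0ℙ⇒< {p} s with p <? a
  ... | yes p<a = p<a
  side≡0ℙ⇒< () | no _

  side-≥ : ∀ {p} → a ≤ p → side p ≡ 1ℙ
  side-≥ {p} a≤p with p <? a
  ... | yes p<a = contradiction a≤p (<⇒≱ p<a)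
  ... | no _    = refl

  Link : ℕ → ℕ → Set
  Link p q = p < j × q ≡ a + p

  Linked : ℕ → ℕ → Set
  Linked p q = Link p q ⊎ Link q p

  linked? : ∀ p q → Dec (Linked p q)
  linked? p q = (p <? j ×-dec q ≟ a + p) ⊎-dec (q <? j ×-dec p ≟ a + q)

  distance : ℕ → ℕ → ℕ
  distance p q with p ≟ q | side p ℙₚ.≟ side q | linked? p q
  ... | yes _ | _     | _     = 0
  ... | no _  | yes _ | _     = 2
  ... | no _  | no _  | yes _ = 3
  ... | no _  | no _  | no _  = 1

  data View (p q : ℕ) : ℕ → Set where
    diagonal  : p ≡ q → View p q 0
    same-side : p ≢ q → side p ≡ side q → View p q 2
    linked    : p ≢ q → side p ≢ side q → Linked p q → View p q 3
    unlinked  : p ≢ q → side p ≢ side q → ¬ Linked p q → View p q 1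

  view : ∀ p q → View p q (distance p q)
  view p q with p ≟ q | side p ℙₚ.≟ side q | linked? p q
  ... | yes p≡q | _     | _     = diagonal p≡q
  ... | no p≢q  | yes s | _     = same-side p≢q s
  ... | no p≢q  | no s  | yes l = linked p≢q s l
  ... | no p≢q  | no s  | no ¬l = unlinked p≢q s ¬l

  distance-refl : ∀ p → distance p p ≡ 0
  distance-refl p with distance p p | view p p
  ... | _ | diagonal _         = refl
  ... | _ | same-side p≢p _    = contradiction refl p≢p
  ... | _ | linked p≢p _ _     = contradiction refl p≢p
  ... | _ | unlinked p≢p _ _   = contradiction refl p≢p

  distance-zero : ∀ {p q} → distance p q ≡ 0 → p ≡ q
  distance-zero {p} {q} e with distance p q | view p q
  ... | _ | diagonal p≡q = p≡q
  distance-zero () | _ | same-side _ _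
  distance-zero () | _ | linked _ _ _
  distance-zero () | _ | unlinked _ _ _

  distance-3⇒linked : ∀ {p q} → distance p q ≡ 3 → Linked p q
  distance-3⇒linked {p} {q} e with distance p q | view p q
  ... | _ | linked _ _ l = l
  distance-3⇒linked () | _ | diagonal _
  distance-3⇒linked () | _ | same-side _ _
  distance-3⇒linked () | _ | unlinked _ _ _

  module _ (j≤a : j ≤ a) where

    link-sides : ∀ {p q} → Link p q → side p ≡ 0ℙ × side q ≡ 1ℙ
    link-sides {p} (p<j , refl) = side-< (<-≤-trans p<j j≤a) , side-≥ (m≤m+n a p)

    link-cross : ∀ {p q} → Link p q → side p ≢ side q
    link-cross l s with link-sides l
    ... | p∈A , q∈B = 0ℙ≢1ℙ (trans (sym p∈A) (trans s q∈B))

    linked-cross : ∀ {p q} → Linked p q → side p ≢ side q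
    linked-cross (inj₁ l) = link-cross l
    linked-cross (inj₂ l) = link-cross l ∘ sym

    linked-unique : ∀ {p q r} → Linked p q → Linked p r → q ≡ r
    linked-unique (inj₁ (_ , refl)) (inj₁ (_ , refl)) = refl
    linked-unique (inj₂ (_ , refl)) (inj₂ (_ , p≡a+r)) = +-cancelˡ-≡ a _ _ p≡a+r
    linked-unique (inj₁ l) (inj₂ l′) = ⊥-elim (0ℙ≢1ℙ (trans (sym (proj₁ (link-sides l))) (proj₂ (link-sides l′))))
    linked-unique (inj₂ l) (inj₁ l′) = ⊥-elim (0ℙ≢1ℙ (trans (sym (proj₁ (link-sides l′))) (proj₂ (link-sides l))))

    distance-same-side : ∀ {p q} → p ≢ q → side p ≡ side q → distance p q ≡ 2
    distance-same-side {p} {q} p≢q s with distance p q | view p q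
    ... | _ | diagonal p≡q     = contradiction p≡q p≢q
    ... | _ | same-side _ _    = refl
    ... | _ | linked _ s′ _    = contradiction s s′
    ... | _ | unlinked _ s′ _  = contradiction s s′

    distance-linked : ∀ {p q} → Linked p q → distance p q ≡ 3
    distance-linked {p} {q} l with distance p q | view p q
    ... | _ | diagonal refl     = contradiction refl (linked-cross l)
    ... | _ | same-side _ s     = contradiction s (linked-cross l)
    ... | _ | linked _ _ _      = refl
    ... | _ | unlinked _ _ ¬l   = contradiction l ¬l

    distance-unlinked : ∀ {p q} → side p ≢ side q → ¬ Linked p q → distance p q ≡ 1
    distance-unlinked {p} {q} s ¬l with distance p q | view p q
    ... | _ | diagonal refl     = contradiction refl s
    ... | _ | same-side _ s′    = contradiction s′ s
    ... | _ | linked _ _ l      = contradiction l ¬l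
    ... | _ | unlinked _ _ _    = refl

    distance-sym : ∀ p q → distance p q ≡ distance q p
    distance-sym p q with distance p q | view p q
    ... | _ | diagonal refl      = sym (distance-refl p)
    ... | _ | same-side p≢q s    = sym (distance-same-side (p≢q ∘ sym) (sym s))
    ... | _ | linked _ _ l       = sym (distance-linked (Sum.swap l))
    ... | _ | unlinked _ s ¬l    = sym (distance-unlinked (s ∘ sym) (¬l ∘ Sum.swap))

matchedBipartition⇒inClass : ∀ {n} (M : MetricSpace n) → MatchedBipartition (dist M) → InClass M
matchedBipartition⇒inClass M B = (λ _ _ → dist-range) , λ _ _ _ → allowed
  where open IsMetric (isMetric M)
        open MatchedBipartitionProperties refl-0 symm B using (dist-range; allowed)

repDist : ∀ {n} (a j : ℕ) → Fin n → Fin n → ℕ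
repDist a j x y = Representative.distance a j (toℕ x) (toℕ y)

module _ {n a j : ℕ} (j≤a : j ≤ a) where
  open Representative a j

  repBipartition : MatchedBipartition (repDist {n} a j)
  repBipartition = record
    { side             = side ∘ toℕ
    ; dist-same-side   = λ x≢y → distance-same-side j≤a (x≢y ∘ Finₚ.toℕ-injective)
    ; dist-cross-side  = λ {x} {y} s → cross (view (toℕ x) (toℕ y)) s
    ; 3-partner-unique = λ e e′ → Finₚ.toℕ-injective
                           (linked-unique j≤a (distance-3⇒linked e) (distance-3⇒linked e′))
    }
    where
    cross : ∀ {p q k} → View p q k → side p ≢ side q → Cross k
    cross (diagonal refl)     s = contradiction refl s
    cross (same-side _ s′)    s = contradiction s′ s
    cross (linked _ _ _)      _ = inj₂ refl
    cross (unlinked _ _ _)    _ = inj₁ refl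

repSpace : ∀ n a j → j ≤ a → MetricSpace n
repSpace n a j j≤a = record
  { dist     = repDist a j
  ; isMetric = record
    { zero-iff = λ _ _ → Finₚ.toℕ-injective ∘ distance-zero
    ; refl-0   = distance-refl ∘ toℕ
    ; symm     = symm
    ; triangle = triangle
    }
  }
  where
  open Representative a j
  symm : ∀ (x y : Fin n) → repDist a j x y ≡ repDist a j y x
  symm x y = distance-sym j≤a (toℕ x) (toℕ y)
  open MatchedBipartitionProperties (distance-refl ∘ toℕ) symm (repBipartition j≤a) using (triangle)

repSpace-inClass : ∀ n a j (j≤a : j ≤ a) → InClass (repSpace n a j j≤a)
repSpace-inClass n a j j≤a = matchedBipartition⇒inClass (repSpace n a j j≤a) (repBipartition j≤a)

repSpace-cong : ∀ {n a a′ j j′} {j≤a : j ≤ a} {j′≤a′ : j′ ≤ a′} → a ≡ a′ → j ≡ j′ →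
                repSpace n a j j≤a ≡ repSpace n a′ j′ j′≤a′
repSpace-cong {j≤a = j≤a} {j′≤a′} refl refl = cong (repSpace _ _ _) (≤-irrelevant j≤a j′≤a′)

-- Isometry invariants

module _ {n} (M : MetricSpace n) where

  -- In a space of the class evenDegree x is the size of the side of x. A point on a side
  -- smaller than n/2 then counts twice in sideInvariant and one on a side of size n/2 once.
  evenDegree : Fin n → ℕ
  evenDegree x = count (λ y → parity (dist M x y) ℙₚ.≟ 0ℙ)

  sideInvariant : ℕ
  sideInvariant = count (λ x → 2 * evenDegree x ≤? n) + count (λ x → 2 * evenDegree x <? n)

  linkInvariant : ℕ
  linkInvariant = count (λ x → any? (λ y → dist M x y ≟ 3))

module _ {n} {M N : MetricSpace n} (iso : Isometric M N) where
  private
    σ : Permutation′ n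
    σ = proj₁ iso
    σ-isometry : ∀ x y → dist N (σ ⟨$⟩ʳ x) (σ ⟨$⟩ʳ y) ≡ dist M x y
    σ-isometry = proj₂ iso

  evenDegree-isometric : ∀ x → evenDegree M x ≡ evenDegree N (σ ⟨$⟩ʳ x)
  evenDegree-isometric x = count-permute _ _ σ λ y →
    mk⇔ (subst (λ k → parity k ≡ 0ℙ) (sym (σ-isometry x y)))
        (subst (λ k → parity k ≡ 0ℙ) (σ-isometry x y))

  sideInvariant-isometric : sideInvariant M ≡ sideInvariant N
  sideInvariant-isometric = cong₂ _+_
    (count-permute _ _ σ λ x → mk⇔ (subst (λ k → 2 * k ≤ n) (evenDegree-isometric x))
                                   (subst (λ k → 2 * k ≤ n) (sym (evenDegree-isometric x))))
    (count-permute _ _ σ λ x → mk⇔ (subst (λ k → 2 * k < n) (evenDegree-isometric x))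
                                   (subst (λ k → 2 * k < n) (sym (evenDegree-isometric x))))

  linkInvariant-isometric : linkInvariant M ≡ linkInvariant N
  linkInvariant-isometric = count-permute _ _ σ λ x → mk⇔
    (λ (y , e) → σ ⟨$⟩ʳ y , trans (σ-isometry x y) e)
    (λ (y , e) → σ ⟨$⟩ˡ y , trans (sym (σ-isometry x (σ ⟨$⟩ˡ y)))
                                 (trans (cong (dist N (σ ⟨$⟩ʳ x)) (inverseʳ σ)) e))

2[n∸m]≤n⇒n≤2m : ∀ {a n} → a ≤ n → 2 * (n ∸ a) ≤ n → n ≤ 2 * a
2[n∸m]≤n⇒n≤2m {a} {n} a≤n 2b≤n = begin
  n         ≡⟨ m+[n∸m]≡n a≤n ⟨
  a + b     ≤⟨ +-monoʳ-≤ a (+-cancelʳ-≤ b b a b+b≤a+b) ⟩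
  a + a     ≡⟨ cong (a +_) (+-identityʳ a) ⟨
  2 * a     ∎
  where
  open ≤-Reasoning
  b : ℕ
  b = n ∸ a
  b+b≤a+b : b + b ≤ a + b
  b+b≤a+b = subst₂ _≤_ (cong (b +_) (+-identityʳ b)) (sym (m+[n∸m]≡n a≤n)) 2b≤n

module _ {n a j : ℕ} (j≤a : j ≤ a) (2a≤n : 2 * a ≤ n) where
  open Representative a j
  private
    R : MetricSpace n
    R = repSpace n a j j≤a
    a≤n : a ≤ n
    a≤n = ≤-trans (m≤m+n a (a + 0)) 2a≤n
    open MatchedBipartitionProperties (IsMetric.refl-0 (isMetric R)) (IsMetric.symm (isMetric R))
                                      (repBipartition j≤a)
      using (even⇔same-side)

  evenDegree-rep-< : ∀ {x} → toℕ x < a → evenDegree R x ≡ a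
  evenDegree-rep-< {x} x<a = trans (count-cong _ (below? {n} a) (to , from)) (count-below a≤n)
    where
    to : ∀ {y} → parity (dist R x y) ≡ 0ℙ → toℕ y < a
    to {y} e = side≡0ℙ⇒< (trans (sym (Equivalence.to (even⇔same-side x y) e)) (side-< x<a))
    from : ∀ {y} → toℕ y < a → parity (dist R x y) ≡ 0ℙ
    from {y} y<a = Equivalence.from (even⇔same-side x y) (trans (side-< x<a) (sym (side-< y<a)))

  evenDegree-rep-≥ : ∀ {x} → a ≤ toℕ x → evenDegree R x ≡ n ∸ a
  evenDegree-rep-≥ {x} a≤x = trans (count-cong _ (∁? (below? {n} a)) (to , from)) (count-not-below a≤n)
    where
    to : ∀ {y} → parity (dist R x y) ≡ 0ℙ → ¬ toℕ y < a
    to {y} e y<a = 0ℙ≢1ℙ (trans (sym (side-< y<a))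
                     (trans (sym (Equivalence.to (even⇔same-side x y) e)) (side-≥ a≤x)))
    from : ∀ {y} → ¬ toℕ y < a → parity (dist R x y) ≡ 0ℙ
    from {y} y≮a = Equivalence.from (even⇔same-side x y) (trans (side-≥ a≤x) (sym (side-≥ (≮⇒≥ y≮a))))

  sideInvariant-rep : sideInvariant R ≡ 2 * a
  sideInvariant-rep = [ unbalanced , balanced ]′ (m≤n⇒m<n∨m≡n 2a≤n)
    where
    open ≡-Reasoning
    unbalanced : 2 * a < n → sideInvariant R ≡ 2 * a
    unbalanced 2a<n = begin
      count (λ x → 2 * evenDegree R x ≤? n) + count (λ x → 2 * evenDegree R x <? n)
        ≡⟨ cong₂ _+_ (count-cong _ (below? {n} a) (in-A , at-A {_≤ n} 2a≤n))
                     (count-cong _ (below? {n} a) (in-A ∘ <⇒≤ , at-A {_< n} 2a<n)) ⟩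
      count (below? {n} a) + count (below? {n} a)
        ≡⟨ cong₂ _+_ (count-below a≤n) (count-below a≤n) ⟩
      a + a
        ≡⟨ cong (a +_) (+-identityʳ a) ⟨
      2 * a ∎
      where
      in-A : ∀ {x} → 2 * evenDegree R x ≤ n → toℕ x < a
      in-A {x} h = decidable-stable (toℕ x <? a) λ x≮a → <⇒≱ 2a<n
        (2[n∸m]≤n⇒n≤2m a≤n (subst (λ k → 2 * k ≤ n) (evenDegree-rep-≥ (≮⇒≥ x≮a)) h))
      at-A : ∀ {P : ℕ → Set} → P (2 * a) → ∀ {x} → toℕ x < a → P (2 * evenDegree R x)
      at-A {P} P2a x<a = subst (λ k → P (2 * k)) (sym (evenDegree-rep-< x<a)) P2a
    balanced : 2 * a ≡ n → sideInvariant R ≡ 2 * a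
    balanced 2a≡n = begin
      count (λ x → 2 * evenDegree R x ≤? n) + count (λ x → 2 * evenDegree R x <? n)
        ≡⟨ cong₂ _+_ (count-all _ (≤-reflexive ∘ 2E≡n)) (count-none _ (<-irrefl ∘ 2E≡n)) ⟩
      n + 0
        ≡⟨ trans (+-identityʳ n) (sym 2a≡n) ⟩
      2 * a ∎
      where
      n∸a≡a : n ∸ a ≡ a
      n∸a≡a = trans (cong (_∸ a) (sym 2a≡n)) (trans (m+n∸m≡n a (a + 0)) (+-identityʳ a))
      2E≡n : ∀ x → 2 * evenDegree R x ≡ n
      2E≡n x = trans (cong (2 *_) ([ (λ a≤x → trans (evenDegree-rep-≥ a≤x) n∸a≡a) , evenDegree-rep-< ]′
                                      (≤-<-connex a (toℕ x)))) 2a≡n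

  private
    a+j≤n : a + j ≤ n
    a+j≤n = ≤-trans (+-monoʳ-≤ a (≤-trans j≤a (≤-reflexive (sym (+-identityʳ a))))) 2a≤n

  partnered-A : ∀ {x} → toℕ x < a → (∃ λ y → dist R x y ≡ 3) ⇔ toℕ x < j
  partnered-A {x} x<a = mk⇔ to from
    where
    to : (∃ λ y → dist R x y ≡ 3) → toℕ x < j
    to (y , e) with distance-3⇒linked e
    ... | inj₁ (x<j , _)   = x<j
    ... | inj₂ (_ , x≡a+y) = contradiction (≤-trans (m≤m+n a _) (≤-reflexive (sym x≡a+y))) (<⇒≱ x<a)
    from : toℕ x < j → ∃ λ y → dist R x y ≡ 3
    from x<j = fromℕ< a+x<n , distance-linked j≤a (inj₁ (x<j , Finₚ.toℕ-fromℕ< a+x<n))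
      where a+x<n : a + toℕ x < n
            a+x<n = <-≤-trans (+-monoʳ-< a x<j) a+j≤n

  partnered-B : ∀ {x} → a ≤ toℕ x → (∃ λ y → dist R x y ≡ 3) ⇔ toℕ x < a + j
  partnered-B {x} a≤x = mk⇔ to from
    where
    a+[x∸a]≡x : a + (toℕ x ∸ a) ≡ toℕ x
    a+[x∸a]≡x = m+[n∸m]≡n a≤x
    to : (∃ λ y → dist R x y ≡ 3) → toℕ x < a + j
    to (y , e) with distance-3⇒linked e
    ... | inj₁ (x<j , _)     = contradiction a≤x (<⇒≱ (<-≤-trans x<j j≤a))
    ... | inj₂ (y<j , x≡a+y) = subst (_< a + j) (sym x≡a+y) (+-monoʳ-< a y<j)
    from : toℕ x < a + j → ∃ λ y → dist R x y ≡ 3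
    from x<a+j = fromℕ< x∸a<n , distance-linked j≤a
      (inj₂ (subst (_< j) (sym toℕ-y) x∸a<j , trans (sym a+[x∸a]≡x) (cong (a +_) (sym toℕ-y))))
      where
      x∸a<j : toℕ x ∸ a < j
      x∸a<j = +-cancelˡ-< a _ j (subst (_< a + j) (sym a+[x∸a]≡x) x<a+j)
      x∸a<n : toℕ x ∸ a < n
      x∸a<n = ≤-trans x∸a<j (≤-trans j≤a a≤n)
      toℕ-y : toℕ (fromℕ< x∸a<n) ≡ toℕ x ∸ a
      toℕ-y = Finₚ.toℕ-fromℕ< x∸a<n

  linkInvariant-rep : linkInvariant R ≡ 2 * j
  linkInvariant-rep = begin
    count partnered?                                       ≡⟨ count-split partnered? (below? a) ⟩
    count (partnered? ∩? below? a) + count (partnered? ∩? ∁? (below? a))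
      ≡⟨ cong₂ _+_ (count-cong _ (below? j) (in-A , from-A)) (count-cong _ interval? (in-B , from-B)) ⟩
    count (below? {n} j) + count interval?                 ≡⟨ cong₂ _+_ (count-below (≤-trans j≤a a≤n))
                                                                         (count-interval a+j≤n) ⟩
    j + j                                                  ≡⟨ cong (j +_) (+-identityʳ j) ⟨
    2 * j                                                  ∎
    where
    open ≡-Reasoning
    Partnered : Fin n → Set
    Partnered x = ∃ λ y → dist R x y ≡ 3
    partnered? : Decidable Partnered
    partnered? x = any? λ y → dist R x y ≟ 3
    interval? : Decidable λ (x : Fin n) → toℕ x < a + j × ¬ toℕ x < a
    interval? = below? (a + j) ∩? ∁? (below? a)
    in-A : ∀ {x} → Partnered x × toℕ x < a → toℕ x < j
    in-A (p , x<a) = Equivalence.to (partnered-A x<a) p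
    from-A : ∀ {x} → toℕ x < j → Partnered x × toℕ x < a
    from-A {x} x<j = Equivalence.from (partnered-A x<a) x<j , x<a
      where x<a : toℕ x < a
            x<a = <-≤-trans x<j j≤a
    in-B : ∀ {x} → Partnered x × ¬ toℕ x < a → toℕ x < a + j × ¬ toℕ x < a
    in-B (p , x≮a) = Equivalence.to (partnered-B (≮⇒≥ x≮a)) p , x≮a
    from-B : ∀ {x} → toℕ x < a + j × ¬ toℕ x < a → Partnered x × ¬ toℕ x < a
    from-B (x<a+j , x≮a) = Equivalence.from (partnered-B (≮⇒≥ x≮a)) x<a+j , x≮a

repSpace-isometric⇒≡ : ∀ {n a a′ j j′} (j≤a : j ≤ a) (j′≤a′ : j′ ≤ a′) → 2 * a ≤ n → 2 * a′ ≤ n →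
                       Isometric (repSpace n a j j≤a) (repSpace n a′ j′ j′≤a′) → a ≡ a′ × j ≡ j′
repSpace-isometric⇒≡ {n} {a} {a′} {j} {j′} j≤a j′≤a′ 2a≤n 2a′≤n iso =
  *-cancelˡ-≡ a a′ 2 (begin
    2 * a             ≡⟨ sideInvariant-rep j≤a 2a≤n ⟨
    sideInvariant R   ≡⟨ sideInvariant-isometric {M = R} {R′} iso ⟩
    sideInvariant R′  ≡⟨ sideInvariant-rep j′≤a′ 2a′≤n ⟩
    2 * a′            ∎) ,
  *-cancelˡ-≡ j j′ 2 (begin
    2 * j             ≡⟨ linkInvariant-rep j≤a 2a≤n ⟨
    linkInvariant R   ≡⟨ linkInvariant-isometric {M = R} {R′} iso ⟩
    linkInvariant R′  ≡⟨ linkInvariant-rep j′≤a′ 2a′≤n ⟩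
    2 * j′            ∎)
  where
  open ≡-Reasoning
  R R′ : MetricSpace n
  R = repSpace n a j j≤a
  R′ = repSpace n a′ j′ j′≤a′

-- Isometry onto a representative

module Classification {n} (M : MetricSpace n) (B : MatchedBipartition (dist M)) where
  open IsMetric (isMetric M)
  open MatchedBipartition B
  private
    d : Fin n → Fin n → ℕ
    d = dist M

  InA : Pred (Fin n) 0ℓ
  InA x = side x ≡ 0ℙ

  Linked : Pred (Fin n) 0ℓ
  Linked x = ∃ λ y → d x y ≡ 3

  inA? : Decidable InA
  inA? x = side x ℙₚ.≟ 0ℙ

  linked? : Decidable Linked
  linked? x = any? λ y → d x y ≟ 3

  A-linked? A-unlinked? B-linked? B-unlinked? : Decidable _
  A-linked? = inA? ∩? linked?
  A-unlinked? = inA? ∩? ∁? linked?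
  B-linked? = ∁? inA? ∩? linked?
  B-unlinked? = ∁? inA? ∩? ∁? linked?

  a j : ℕ
  a = count inA?
  j = count A-linked?

  3⇒cross-side : ∀ {x y} → d x y ≡ 3 → side x ≢ side y
  3⇒cross-side e s = contradiction (trans (sym e) (dist-same-side (dist≡suc⇒≢ M e) s)) λ ()

  3-partner-A-linked : ∀ {x p} → ¬ InA x → d x p ≡ 3 → InA p × Linked p
  3-partner-A-linked {x} {p} x∉A e = ≢∧≢⇒≡ (3⇒cross-side e ∘ sym) x∉A , x , trans (symm p x) e

  partner : Fin n → Fin n
  partner x with linked? x
  ... | yes (p , _) = p
  ... | no _        = x

  partner-3 : ∀ {x} → Linked x → d x (partner x) ≡ 3
  partner-3 {x} l with linked? x
  ... | yes (_ , e) = e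
  ... | no ¬l       = contradiction l ¬l

  partner-injective : ∀ {x y} → Linked x → Linked y → partner x ≡ partner y → x ≡ y
  partner-injective {x} {y} lx ly e = 3-partner-unique (trans (symm (partner x) x) (partner-3 lx))
    (trans (symm (partner x) y) (subst (λ p → d y p ≡ 3) (sym e) (partner-3 ly)))

  j≤a : j ≤ a
  j≤a = count-mono A-linked? inA? proj₁

  a≡j+|A-unlinked| : a ≡ j + count A-unlinked?
  a≡j+|A-unlinked| = count-split inA? linked?

  j≤|B-linked| : j ≤ count B-linked?
  j≤|B-linked| = count-injection A-linked? B-linked? partner
    (λ {x} (x∈A , l) → (λ p∈A → 3⇒cross-side (partner-3 l) (trans x∈A (sym p∈A))) ,
                       x , trans (symm _ x) (partner-3 l))
    λ (_ , lx) (_ , ly) → partner-injective lx ly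

  a+|B|≡n : a + (count B-linked? + count B-unlinked?) ≡ n
  a+|B|≡n = trans (cong (a +_) (sym (count-split (∁? inA?) linked?))) (count-∁ inA?)

  position : Fin n → ℕ
  position x with inA? x | linked? x
  ... | yes _ | yes _ = rank A-linked? x
  ... | yes _ | no _  = j + rank A-unlinked? x
  ... | no _  | yes _ = a + rank A-linked? (partner x)
  ... | no _  | no _  = a + j + rank B-unlinked? x

  data Placement (x : Fin n) : ℕ → Set where
    A-linked   : InA x → Linked x → Placement x (rank A-linked? x)
    A-unlinked : InA x → ¬ Linked x → Placement x (j + rank A-unlinked? x)
    B-linked   : ¬ InA x → Linked x → Placement x (a + rank A-linked? (partner x))
    B-unlinked : ¬ InA x → ¬ Linked x → Placement x (a + j + rank B-unlinked? x)

  placement : ∀ x → Placement x (position x)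
  placement x with inA? x | linked? x
  ... | yes x∈A | yes l  = A-linked x∈A l
  ... | yes x∈A | no ¬l  = A-unlinked x∈A ¬l
  ... | no x∉A  | yes l  = B-linked x∉A l
  ... | no x∉A  | no ¬l  = B-unlinked x∉A ¬l

  partner-A-linked : ∀ {x} → ¬ InA x → Linked x → InA (partner x) × Linked (partner x)
  partner-A-linked x∉A l = 3-partner-A-linked x∉A (partner-3 l)

  position-A : ∀ {x} → InA x → position x < a
  position-A {x} x∈A with position x | placement x
  ... | _ | A-linked x∈A l    = <-≤-trans (rank-< A-linked? (x∈A , l)) j≤a
  ... | _ | A-unlinked x∈A ¬l = subst (j + rank A-unlinked? x <_) (sym a≡j+|A-unlinked|)
                                    (+-monoʳ-< j (rank-< A-unlinked? (x∈A , ¬l)))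
  ... | _ | B-linked x∉A _    = contradiction x∈A x∉A
  ... | _ | B-unlinked x∉A _  = contradiction x∈A x∉A

  position-B : ∀ {x} → ¬ InA x → a ≤ position x × position x < n
  position-B {x} x∉A with position x | placement x
  ... | _ | A-linked x∈A _    = contradiction x∈A x∉A
  ... | _ | A-unlinked x∈A _  = contradiction x∈A x∉A
  ... | _ | B-linked _ l      = m≤m+n a _ , (begin-strict
    a + rank A-linked? (partner x)   <⟨ +-monoʳ-< a (rank-< A-linked? (partner-A-linked x∉A l)) ⟩
    a + j                      ≤⟨ +-monoʳ-≤ a (≤-trans j≤|B-linked| (m≤m+n _ _)) ⟩
    a + (count B-linked? + count B-unlinked?) ≡⟨ a+|B|≡n ⟩
    n                          ∎)
    where open ≤-Reasoning
  ... | _ | B-unlinked _ ¬l   = ≤-trans (m≤m+n a j) (m≤m+n (a + j) _) , (begin-strict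
    a + j + rank B-unlinked? x          <⟨ +-monoʳ-< (a + j) (rank-< B-unlinked? (x∉A , ¬l)) ⟩
    a + j + count B-unlinked?           ≡⟨ +-assoc a j _ ⟩
    a + (j + count B-unlinked?)         ≤⟨ +-monoʳ-≤ a (+-monoˡ-≤ _ j≤|B-linked|) ⟩
    a + (count B-linked? + count B-unlinked?) ≡⟨ a+|B|≡n ⟩
    n                           ∎)
    where open ≤-Reasoning

  position-< : ∀ x → position x < n
  position-< x = bound (inA? x)
    where
    bound : Dec (InA x) → position x < n
    bound (yes x∈A) = <-≤-trans (position-A x∈A) (subst (a ≤_) a+|B|≡n (m≤m+n a _))
    bound (no x∉A)  = proj₂ (position-B x∉A)

  A-linked<A-unlinked : ∀ {z} → InA z → Linked z → ∀ {r} → rank A-linked? z < j + r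
  A-linked<A-unlinked z∈A lz = <-≤-trans (rank-< A-linked? (z∈A , lz)) (m≤m+n j _)

  position-injective-A : ∀ {x y} → InA x → InA y → position x ≡ position y → x ≡ y
  position-injective-A {x} {y} x∈A y∈A e with position x | placement x | position y | placement y
  ... | _ | A-linked _ lx    | _ | A-linked _ ly    = rank-injective A-linked? (x∈A , lx) (y∈A , ly) e
  ... | _ | A-linked _ lx    | _ | A-unlinked _ _   = contradiction e (<⇒≢ (A-linked<A-unlinked x∈A lx))
  ... | _ | A-unlinked _ _   | _ | A-linked _ ly    = contradiction (sym e) (<⇒≢ (A-linked<A-unlinked y∈A ly))
  ... | _ | A-unlinked _ ¬lx | _ | A-unlinked _ ¬ly =
    rank-injective A-unlinked? (x∈A , ¬lx) (y∈A , ¬ly) (+-cancelˡ-≡ j _ _ e)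
  ... | _ | B-linked x∉A _   | _ | _ = contradiction x∈A x∉A
  ... | _ | B-unlinked x∉A _ | _ | _ = contradiction x∈A x∉A
  ... | _ | _ | _ | B-linked y∉A _   = contradiction y∈A y∉A
  ... | _ | _ | _ | B-unlinked y∉A _ = contradiction y∈A y∉A

  B-linked<B-unlinked : ∀ {z} → ¬ InA z → Linked z → ∀ {r} → a + rank A-linked? (partner z) < a + j + r
  B-linked<B-unlinked z∉A lz =
    <-≤-trans (+-monoʳ-< a (rank-< A-linked? (partner-A-linked z∉A lz))) (m≤m+n (a + j) _)

  position-injective-B : ∀ {x y} → ¬ InA x → ¬ InA y → position x ≡ position y → x ≡ y
  position-injective-B {x} {y} x∉A y∉A e with position x | placement x | position y | placement y
  ... | _ | B-linked _ lx    | _ | B-linked _ ly    =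
    partner-injective lx ly
      (rank-injective A-linked? (partner-A-linked x∉A lx) (partner-A-linked y∉A ly) (+-cancelˡ-≡ a _ _ e))
  ... | _ | B-linked _ lx    | _ | B-unlinked _ _   = contradiction e (<⇒≢ (B-linked<B-unlinked x∉A lx))
  ... | _ | B-unlinked _ _   | _ | B-linked _ ly    = contradiction (sym e) (<⇒≢ (B-linked<B-unlinked y∉A ly))
  ... | _ | B-unlinked _ ¬lx | _ | B-unlinked _ ¬ly =
    rank-injective B-unlinked? (x∉A , ¬lx) (y∉A , ¬ly) (+-cancelˡ-≡ (a + j) _ _ e)
  ... | _ | A-linked x∈A _   | _ | _ = contradiction x∈A x∉A
  ... | _ | A-unlinked x∈A _ | _ | _ = contradiction x∈A x∉A
  ... | _ | _ | _ | A-linked y∈A _   = contradiction y∈A y∉A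
  ... | _ | _ | _ | A-unlinked y∈A _ = contradiction y∈A y∉A

  position-injective : ∀ {x y} → position x ≡ position y → x ≡ y
  position-injective {x} {y} e = by-side (inA? x) (inA? y)
    where
    A<B : ∀ {u v} → InA u → ¬ InA v → position u < position v
    A<B u∈A v∉A = <-≤-trans (position-A u∈A) (proj₁ (position-B v∉A))
    by-side : Dec (InA x) → Dec (InA y) → x ≡ y
    by-side (yes x∈A) (yes y∈A) = position-injective-A x∈A y∈A e
    by-side (no x∉A)  (no y∉A)  = position-injective-B x∉A y∉A e
    by-side (yes x∈A) (no y∉A)  = contradiction e (<⇒≢ (A<B x∈A y∉A))
    by-side (no x∉A)  (yes y∈A) = contradiction (sym e) (<⇒≢ (A<B y∈A x∉A))

  module R = Representative a j

  repSide-position : ∀ x → R.side (position x) ≡ side x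
  repSide-position x = by-side (inA? x)
    where
    by-side : Dec (InA x) → R.side (position x) ≡ side x
    by-side (yes x∈A) = trans (R.side-< (position-A x∈A)) (sym x∈A)
    by-side (no x∉A)  = trans (R.side-≥ (proj₁ (position-B x∉A))) (≢∧≢⇒≡ (λ ()) (x∉A ∘ sym))

  dist≡3⇒linked : ∀ {x y} → InA x → ¬ InA y → d x y ≡ 3 → R.Linked (position x) (position y)
  dist≡3⇒linked {x} {y} x∈A y∉A e with position x | placement x | position y | placement y
  ... | _ | A-linked _ _     | _ | B-linked _ ly    =
    inj₁ (rank-< A-linked? (x∈A , y , e) ,
          cong (λ p → a + rank A-linked? p) (3-partner-unique (partner-3 ly) (trans (symm y x) e)))
  ... | _ | A-unlinked _ ¬lx | _ | _                = contradiction (y , e) ¬lx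
  ... | _ | _                | _ | B-unlinked _ ¬ly = contradiction (x , trans (symm y x) e) ¬ly
  ... | _ | B-linked x∉A _   | _ | _ = contradiction x∈A x∉A
  ... | _ | B-unlinked x∉A _ | _ | _ = contradiction x∈A x∉A
  ... | _ | _ | _ | A-linked y∈A _   = contradiction y∈A y∉A
  ... | _ | _ | _ | A-unlinked y∈A _ = contradiction y∈A y∉A

  linked⇒dist≡3 : ∀ {x y} → InA x → ¬ InA y → R.Linked (position x) (position y) → d x y ≡ 3
  linked⇒dist≡3 {x} {y} x∈A y∉A (inj₂ (py<j , _)) =
    contradiction (≤-trans j≤a (proj₁ (position-B y∉A))) (<⇒≱ py<j)
  linked⇒dist≡3 {x} {y} x∈A y∉A (inj₁ link) with position x | placement x | position y | placement y
  ... | _ | A-linked _ lx    | _ | B-linked _ ly    = trans (symm x y)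
    (subst (λ p → d y p ≡ 3)
      (rank-injective A-linked? (partner-A-linked y∉A ly) (x∈A , lx) (+-cancelˡ-≡ a _ _ (proj₂ link)))
      (partner-3 ly))
  ... | _ | A-linked _ lx    | _ | B-unlinked _ _   = contradiction (proj₂ link)
    (≢-sym (<⇒≢ (<-≤-trans (+-monoʳ-< a (rank-< A-linked? (x∈A , lx))) (m≤m+n (a + j) _))))
  ... | _ | A-unlinked _ _   | _ | _ = contradiction (proj₁ link) (≤⇒≯ (m≤m+n j _))
  ... | _ | B-linked x∉A _   | _ | _ = contradiction x∈A x∉A
  ... | _ | B-unlinked x∉A _ | _ | _ = contradiction x∈A x∉A
  ... | _ | _ | _ | A-linked y∈A _   = contradiction y∈A y∉A
  ... | _ | _ | _ | A-unlinked y∈A _ = contradiction y∈A y∉A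

  position-cross : ∀ {x y} → InA x → ¬ InA y → R.distance (position x) (position y) ≡ d x y
  position-cross {x} {y} x∈A y∉A = by-distance (dist-cross-side x≁y)
    where
    x≁y : side x ≢ side y
    x≁y s = y∉A (trans (sym s) x∈A)
    by-distance : Cross (d x y) → R.distance (position x) (position y) ≡ d x y
    by-distance (inj₁ e₁) = trans (R.distance-unlinked j≤a
      (λ s → x≁y (trans (sym (repSide-position x)) (trans s (repSide-position y))))
      (λ l → contradiction (trans (sym e₁) (linked⇒dist≡3 x∈A y∉A l)) λ ())) (sym e₁)
    by-distance (inj₂ e₃) = trans (R.distance-linked j≤a (dist≡3⇒linked x∈A y∉A e₃)) (sym e₃)

  position-isometric : ∀ x y → R.distance (position x) (position y) ≡ d x y
  position-isometric x y = by-cases (x Finₚ.≟ y) (inA? x) (inA? y)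
    where
    same-side : x ≢ y → side x ≡ side y → R.distance (position x) (position y) ≡ d x y
    same-side x≢y s = trans (R.distance-same-side j≤a (x≢y ∘ position-injective)
      (trans (repSide-position x) (trans s (sym (repSide-position y))))) (sym (dist-same-side x≢y s))
    by-cases : Dec (x ≡ y) → Dec (InA x) → Dec (InA y) → R.distance (position x) (position y) ≡ d x y
    by-cases (yes refl) _ _ = trans (R.distance-refl (position x)) (sym (refl-0 x))
    by-cases (no _) (yes x∈A) (no y∉A) = position-cross x∈A y∉A
    by-cases (no _) (no x∉A) (yes y∈A) =
      trans (R.distance-sym j≤a _ _) (trans (position-cross y∈A x∉A) (symm y x))
    by-cases (no x≢y) (yes x∈A) (yes y∈A) = same-side x≢y (trans x∈A (sym y∈A))
    by-cases (no x≢y) (no x∉A) (no y∉A) = same-side x≢y (≢∧≢⇒≡ x∉A (y∉A ∘ sym))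

  isometric-rep : Isometric M (repSpace n a j j≤a)
  isometric-rep = σ , λ x y → begin
    R.distance (toℕ (σ ⟨$⟩ʳ x)) (toℕ (σ ⟨$⟩ʳ y))   ≡⟨ cong₂ R.distance (toℕ-embed x) (toℕ-embed y) ⟩
    R.distance (position x) (position y)           ≡⟨ position-isometric x y ⟩
    d x y                                          ∎
    where
    open ≡-Reasoning
    embed : Fin n → Fin n
    embed x = fromℕ< (position-< x)
    toℕ-embed′ : ∀ x → toℕ (embed x) ≡ position x
    toℕ-embed′ x = Finₚ.toℕ-fromℕ< (position-< x)
    embed-permutation : Σ (Permutation′ n) λ σ → ∀ x → σ ⟨$⟩ʳ x ≡ embed x
    embed-permutation = injective⇒permutation embed λ e →
      position-injective (trans (sym (toℕ-embed′ _)) (trans (cong toℕ e) (toℕ-embed′ _)))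
    σ : Permutation′ n
    σ = proj₁ embed-permutation
    toℕ-embed : ∀ x → toℕ (σ ⟨$⟩ʳ x) ≡ position x
    toℕ-embed x = trans (cong toℕ (proj₂ embed-permutation x)) (toℕ-embed′ x)

m+n≡o⇒2m≤o⊎2n≤o : ∀ {m n o} → m + n ≡ o → 2 * m ≤ o ⊎ 2 * n ≤ o
m+n≡o⇒2m≤o⊎2n≤o {m} {n} refl with ≤-total m n
... | inj₁ m≤n = inj₁ (subst (_≤ m + n) (cong (m +_) (sym (+-identityʳ m))) (+-monoʳ-≤ m m≤n))
... | inj₂ n≤m = inj₂ (subst₂ _≤_ (cong (n +_) (sym (+-identityʳ n))) (+-comm n m) (+-monoʳ-≤ n n≤m))

sides-partition : ∀ {n} (M : MetricSpace n) (B : MatchedBipartition (dist M)) →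
                  Classification.a M B + Classification.a M (MatchedBipartition.flip-sides B) ≡ n
sides-partition M B =
  trans (cong (a +_) (count-cong _ (∁? inA?) (⁻¹≡0ℙ⇒≢0ℙ , ≢0ℙ⇒⁻¹≡0ℙ))) (count-∁ inA?)
  where open Classification M B using (a; inA?)

bipartition⇒isometric-rep : ∀ {n} (M : MetricSpace n) → MatchedBipartition (dist M) →
  ∃₂ λ a j → Σ (j ≤ a) λ j≤a → 2 * a ≤ n × Isometric M (repSpace n a j j≤a)
bipartition⇒isometric-rep M B with m+n≡o⇒2m≤o⊎2n≤o {Classification.a M B} (sides-partition M B)
... | inj₁ small = _ , _ , Classification.j≤a M B , small , Classification.isometric-rep M B
... | inj₂ small = _ , _ , Classification.j≤a M B′ , small , Classification.isometric-rep M B′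
  where B′ = MatchedBipartition.flip-sides B

-- Enumerating the parameters (a, j)

triangular : ℕ → ℕ
triangular zero    = 0
triangular (suc k) = triangular k + suc k

2*triangular : ∀ k → 2 * triangular k ≡ k * suc k
2*triangular zero    = refl
2*triangular (suc k) = begin
  2 * (triangular k + suc k)         ≡⟨ *-distribˡ-+ 2 (triangular k) (suc k) ⟩
  2 * triangular k + 2 * suc k       ≡⟨ cong (_+ 2 * suc k) (2*triangular k) ⟩
  k * suc k + 2 * suc k              ≡⟨ step k ⟩
  suc k * suc (suc k)                ∎
  where
  open ≡-Reasoning
  step : ∀ k → k * suc k + 2 * suc k ≡ suc k * suc (suc k)
  step = solve-∀

parameterPair : ∀ k → Fin (triangular k) → ℕ × ℕ
parameterPair (suc k) i = [ parameterPair k , (k ,_) ∘ toℕ ]′ (splitAt (triangular k) i)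

parameterPair-valid : ∀ k i → let (a , j) = parameterPair k i in j ≤ a × a < k
parameterPair-valid (suc k) i with splitAt (triangular k) i
... | inj₁ i′ = map₂ m<n⇒m<1+n (parameterPair-valid k i′)
... | inj₂ r  = s≤s⁻¹ (Finₚ.toℕ<n r) , ≤-refl

parameterPair-injective : ∀ k {i i′} → parameterPair k i ≡ parameterPair k i′ → i ≡ i′
parameterPair-injective (suc k) {i} {i′} e = begin
  i                                     ≡⟨ Finₚ.join-splitAt (triangular k) (suc k) i ⟨
  join _ _ (splitAt (triangular k) i)   ≡⟨ cong (join _ _) (level-injective (splitAt _ i) (splitAt _ i′) e) ⟩
  join _ _ (splitAt (triangular k) i′)  ≡⟨ Finₚ.join-splitAt (triangular k) (suc k) i′ ⟩
  i′                                    ∎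
  where
  open ≡-Reasoning
  level-injective : ∀ s s′ → [ parameterPair k , (k ,_) ∘ toℕ ]′ s ≡ [ parameterPair k , (k ,_) ∘ toℕ ]′ s′ →
                    s ≡ s′
  level-injective (inj₁ u) (inj₁ u′) e = cong inj₁ (parameterPair-injective k e)
  level-injective (inj₂ r) (inj₂ r′) e = cong inj₂ (Finₚ.toℕ-injective (cong proj₂ e))
  level-injective (inj₁ u) (inj₂ _)  e = contradiction (cong proj₁ e) (<⇒≢ (proj₂ (parameterPair-valid k u)))
  level-injective (inj₂ _) (inj₁ u′) e = contradiction (cong proj₁ e) (>⇒≢ (proj₂ (parameterPair-valid k u′)))

parameterPair-surjective : ∀ k {a j} → j ≤ a → a < k → ∃ λ i → parameterPair k i ≡ (a , j)
parameterPair-surjective (suc k) {a} {j} j≤a a<1+k with a ≟ k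
... | yes refl = triangular k ↑ʳ fromℕ< (s≤s j≤a) , (begin
  parameterPair (suc k) (triangular k ↑ʳ fromℕ< (s≤s j≤a))
    ≡⟨ cong [ parameterPair k , (k ,_) ∘ toℕ ]′ (Finₚ.splitAt-↑ʳ (triangular k) (suc k) _) ⟩
  k , toℕ (fromℕ< (s≤s j≤a))
    ≡⟨ cong (k ,_) (Finₚ.toℕ-fromℕ< (s≤s j≤a)) ⟩
  k , j ∎)
  where open ≡-Reasoning
... | no a≢k with parameterPair-surjective k j≤a (≤∧≢⇒< (s≤s⁻¹ a<1+k) a≢k)
... | i , e = i ↑ˡ suc k ,
  trans (cong [ parameterPair k , (k ,_) ∘ toℕ ]′ (Finₚ.splitAt-↑ˡ (triangular k) i (suc k))) e

-- Counting the isometry classes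

m≤n/2⇒2m≤n : ∀ {a n} → a ≤ n / 2 → 2 * a ≤ n
m≤n/2⇒2m≤n {a} {n} a≤n/2 = ≤-trans (*-monoʳ-≤ 2 a≤n/2) (subst (_≤ n) (*-comm (n / 2) 2) (m/n*n≤m n 2))

2m≤n⇒m≤n/2 : ∀ {a n} → 2 * a ≤ n → a ≤ n / 2
2m≤n⇒m≤n/2 {a} {n} 2a≤n = subst (_≤ n / 2) (m*n/n≡m a 2) (/-monoˡ-≤ 2 (subst (_≤ n) (*-comm 2 a) 2a≤n))

numIsoClasses : ∀ n → 1 ≤ n → NumIsoClasses n (triangular (suc (n / 2)))
numIsoClasses n@(suc _) _ = rep , rep-inClass , rep-distinct , rep-complete
  where
  k : ℕ
  k = suc (n / 2)
  valid : ∀ i → proj₂ (parameterPair k i) ≤ proj₁ (parameterPair k i)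
  valid i = proj₁ (parameterPair-valid k i)
  small : ∀ i → 2 * proj₁ (parameterPair k i) ≤ n
  small i = m≤n/2⇒2m≤n (s≤s⁻¹ (proj₂ (parameterPair-valid k i)))
  rep : Fin (triangular k) → MetricSpace n
  rep i = repSpace n (proj₁ (parameterPair k i)) (proj₂ (parameterPair k i)) (valid i)
  rep-inClass : ∀ i → InClass (rep i)
  rep-inClass i = repSpace-inClass n _ _ (valid i)
  rep-distinct : ∀ i i′ → i ≢ i′ → ¬ Isometric (rep i) (rep i′)
  rep-distinct i i′ i≢i′ iso = i≢i′ (parameterPair-injective k (uncurry (cong₂ _,_)
    (repSpace-isometric⇒≡ (valid i) (valid i′) (small i) (small i′) iso)))
  rep-complete : ∀ M → InClass M → Σ (Fin (triangular k)) λ i → Isometric M (rep i)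
  rep-complete M inM with bipartition⇒isometric-rep M (inClass⇒matchedBipartition M inM zero)
  ... | a , j , j≤a , 2a≤n , iso with parameterPair-surjective k j≤a (s≤s (2m≤n⇒m≤n/2 2a≤n))
  ... | i , e = i , subst (Isometric M)
                           (repSpace-cong {j≤a = j≤a} {valid i} (cong proj₁ (sym e)) (cong proj₂ (sym e))) iso

theorem2p9 : ∀ (n : ℕ) → 1 ≤ n →
    Σ ℕ λ k → NumIsoClasses n k × (2 * k ≡ (n / 2) * (n / 2) + 3 * (n / 2) + 2)
theorem2p9 n 1≤n = triangular (suc (n / 2)) , numIsoClasses n 1≤n ,
  trans (2*triangular (suc (n / 2))) (expand (n / 2))
  where
  expand : ∀ m → suc m * suc (suc m) ≡ m * m + 3 * m + 2
  expand = solve-∀
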